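{- Let $X$, $Y$, $Z$ be three pairwise disjoint finite sets of variables. Then the sets $\Delta=\{e_l(X\cup Z)-e_l(Y\cup Z): l>0\}$ and $\Delta'=\{e_l(X)-e_l(Y): l>0\}$ generate the same ideal of $\mathbb{Z}[X\cup Y\cup Z]$. In particular, for any directed graph $G$, the incidence ideal $I(G)$ of $\mathbb{Z}[E(G)]$ admits a set of generators lying in $\mathbb{Z}[E(G)\setminus L(G)]$, where $L(G)$ is the set of loop edges of $G$.
   Context: $e_l(S)$ denotes the $l$-th elementary symmetric polynomial in a finite set $S$ of variables ($e_0=1$, $e_l=0$ for $l>|S|$). A directed graph $G$ has finite vertex and edge sets, each edge having an initial and a terminal vertex; loops (edges with equal initial and terminal vertex) and multiple edges allowed. For a vertex $v$ with outgoing edges $x_1,\dots,x_m$ and incoming edges $y_1,\dots,y_n$ (a loop at $v$ appears in both lists), let $k_v=\max\{m,n\}$ and $\delta_{v,l}=e_l(x_1,\dots,x_m)-e_l(y_1,\dots,y_n)$ for $1\le l\le k_v$. The incidence ideal $I(G)\subset\mathbb{Z}[E(G)]$ is generated by all $\delta_{v,l}$. -}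

module Defs where

open import Data.Nat using (ℕ; zero; suc; _⊔_)
open import Data.Integer using (ℤ; 0ℤ; 1ℤ) renaming (_+_ to _+ℤ_; _*_ to _*ℤ_; -_ to -ℤ_)
open import Data.Fin using (Fin; toℕ; _≟_)
open import Data.List using (List; []; _∷_; map; filter; length; _++_; allFin)
open import Data.Sum using (_⊎_; inj₁; inj₂)
open import Data.Product using (Σ; _×_; _,_; proj₁)
open import Relation.Nullary using (¬_)
open import Relation.Binary.PropositionalEquality using (_≡_)
open import Function using (_∘_)

-- The polynomial ring ℤ[V]: the free commutative ring on variables V,
-- presented as expressions modulo the congruence generated by the
-- commutative-ring axioms and the ring structure of integer constants.

infixl 6 _⊕_
infixl 7 _⊗_
infix 4 _≈_

data Expr (V : Set) : Set where
  var : V → Expr V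
  con : ℤ → Expr V
  _⊕_ : Expr V → Expr V → Expr V
  _⊗_ : Expr V → Expr V → Expr V
  ⊝_  : Expr V → Expr V

data _≈_ {V : Set} : Expr V → Expr V → Set where
  ≈-refl  : ∀ {p} → p ≈ p
  ≈-sym   : ∀ {p q} → p ≈ q → q ≈ p
  ≈-trans : ∀ {p q r} → p ≈ q → q ≈ r → p ≈ r
  ⊕-cong  : ∀ {p p' q q'} → p ≈ p' → q ≈ q' → p ⊕ q ≈ p' ⊕ q'
  ⊗-cong  : ∀ {p p' q q'} → p ≈ p' → q ≈ q' → p ⊗ q ≈ p' ⊗ q'
  ⊝-cong  : ∀ {p q} → p ≈ q → ⊝ p ≈ ⊝ q
  ⊕-assoc : ∀ p q r → (p ⊕ q) ⊕ r ≈ p ⊕ (q ⊕ r)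
  ⊕-comm  : ∀ p q → p ⊕ q ≈ q ⊕ p
  ⊕-idʳ   : ∀ p → p ⊕ con 0ℤ ≈ p
  ⊕-invʳ  : ∀ p → p ⊕ (⊝ p) ≈ con 0ℤ
  ⊗-assoc : ∀ p q r → (p ⊗ q) ⊗ r ≈ p ⊗ (q ⊗ r)
  ⊗-comm  : ∀ p q → p ⊗ q ≈ q ⊗ p
  ⊗-idʳ   : ∀ p → p ⊗ con 1ℤ ≈ p
  distribʳ : ∀ p q r → (p ⊕ q) ⊗ r ≈ (p ⊗ r) ⊕ (q ⊗ r)
  con-+   : ∀ a b → con (a +ℤ b) ≈ con a ⊕ con b
  con-*   : ∀ a b → con (a *ℤ b) ≈ con a ⊗ con b
  con--   : ∀ a → con (-ℤ a) ≈ ⊝ con a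

_⊖_ : ∀ {V} → Expr V → Expr V → Expr V
p ⊖ q = p ⊕ (⊝ q)

-- Change of variables (used for the inclusion ℤ[W] ⊆ ℤ[V] along W → V).
rename : ∀ {V W : Set} → (V → W) → Expr V → Expr W
rename f (var v) = var (f v)
rename f (con a) = con a
rename f (p ⊕ q) = rename f p ⊕ rename f q
rename f (p ⊗ q) = rename f p ⊗ rename f q
rename f (⊝ p)   = ⊝ rename f p

e : ∀ {V} → ℕ → List (Expr V) → Expr V
e zero    _        = con 1ℤ
e (suc l) []       = con 0ℤ
e (suc l) (x ∷ xs) = e (suc l) xs ⊕ (x ⊗ e l xs)

lincomb : ∀ {V I : Set} → (I → Expr V) → List (I × Expr V) → Expr V
lincomb g []             = con 0ℤ
lincomb g ((i , c) ∷ cs) = (c ⊗ g i) ⊕ lincomb g cs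

_∈Ideal_ : ∀ {V I : Set} → Expr V → (I → Expr V) → Set
_∈Ideal_ {V} {I} p g = Σ (List (I × Expr V)) λ cs → p ≈ lincomb g cs

SameIdeal : ∀ {V I J : Set} → (I → Expr V) → (J → Expr V) → Set
SameIdeal {V} g h = ∀ (p : Expr V) → (p ∈Ideal g → p ∈Ideal h) × (p ∈Ideal h → p ∈Ideal g)

-- Part 1: X = {x_0..x_{a-1}}, Y = {y_0..y_{b-1}}, Z = {z_0..z_{c-1}},
-- pairwise disjoint; variable set X ∪ Y ∪ Z = Fin a ⊎ (Fin b ⊎ Fin c).

XYZ : ℕ → ℕ → ℕ → Set
XYZ a b c = Fin a ⊎ (Fin b ⊎ Fin c)

Xs : ∀ a b c → List (Expr (XYZ a b c))
Xs a b c = map (var ∘ inj₁) (allFin a)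

Ys : ∀ a b c → List (Expr (XYZ a b c))
Ys a b c = map (var ∘ inj₂ ∘ inj₁) (allFin b)

Zs : ∀ a b c → List (Expr (XYZ a b c))
Zs a b c = map (var ∘ inj₂ ∘ inj₂) (allFin c)

-- Δ, indexed by l-1 : ℕ (i.e. l = suc k ranges over l > 0).
Δ : ∀ a b c → ℕ → Expr (XYZ a b c)
Δ a b c k = e (suc k) (Xs a b c ++ Zs a b c) ⊖ e (suc k) (Ys a b c ++ Zs a b c)

Δ′ : ∀ a b c → ℕ → Expr (XYZ a b c)
Δ′ a b c k = e (suc k) (Xs a b c) ⊖ e (suc k) (Ys a b c)

-- Part 2: directed graphs (finite, loops and multiple edges allowed).

record Graph : Set where
  field
    nV  : ℕ
    nE  : ℕ
    src : Fin nE → Fin nV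
    tgt : Fin nE → Fin nV
open Graph public

outEdges : (G : Graph) → Fin (nV G) → List (Expr (Fin (nE G)))
outEdges G v = map var (filter (λ x → src G x ≟ v) (allFin (nE G)))

inEdges : (G : Graph) → Fin (nV G) → List (Expr (Fin (nE G)))
inEdges G v = map var (filter (λ x → tgt G x ≟ v) (allFin (nE G)))

kv : (G : Graph) → Fin (nV G) → ℕ
kv G v = length (outEdges G v) ⊔ length (inEdges G v)

-- Index set of the generators δ_{v,l}, 1 ≤ l ≤ k_v  (l = suc (toℕ i)).
IncIndex : Graph → Set
IncIndex G = Σ (Fin (nV G)) λ v → Fin (kv G v)

δ : (G : Graph) → IncIndex G → Expr (Fin (nE G))
δ G (v , i) = e (suc (toℕ i)) (outEdges G v) ⊖ e (suc (toℕ i)) (inEdges G v)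

NonLoop : Graph → Set
NonLoop G = Σ (Fin (nE G)) λ x → ¬ (src G x ≡ tgt G x)

-- With δₗ(S, T) = eₗ(S) − eₗ(T), the recurrence eₗ(z ∷ S) = eₗ(S) + z eₗ₋₁(S) gives
-- δ₁(z ∷ S, z ∷ T) = δ₁(S, T) and δₗ₊₁(z ∷ S, z ∷ T) = δₗ₊₁(S, T) + z δₗ(S, T).
-- This relation is unitriangular, so for every n the first n differences before and
-- after adjoining a common variable z generate the same ideal; removing the common
-- variables Z one at a time gives the first statement. At a vertex v every loop is
-- both an outgoing and an incoming edge, so the loops form a common set Z, and
-- removing them vertex by vertex gives generators of I(G) free of loop variables.
module Submission where

open import Defs
open import Level using (0ℓ)
open import Algebra.Bundles using (CommutativeRing)
open import Algebra.Structures using (IsCommutativeRing)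
open import Algebra.Solver.Ring.AlmostCommutativeRing
  using (fromCommutativeRing; _-Raw-AlmostCommutative⟶_)
open import Data.Integer using (ℤ; 0ℤ; 1ℤ) renaming (-_ to -ℤ_)
import Data.Integer as ℤ
import Data.Integer.Properties as ℤ
open import Data.Nat using (ℕ; zero; suc; _<_)
open import Data.Nat.Properties using (n<1+n; <-trans)
open import Data.Fin using (Fin; toℕ; fromℕ<; _≟_)
open import Data.Fin.Properties using (toℕ-fromℕ<; toℕ<n)
open import Data.List using (List; []; _∷_; map; filter; _++_; allFin)
open import Data.List.Properties using (map-∘)
open import Data.List.Relation.Binary.Permutation.Propositional
  using (_↭_; prep; swap; ↭-sym; ↭-trans)
import Data.List.Relation.Binary.Permutation.Propositional as ↭
open import Data.List.Relation.Binary.Permutation.Propositional.Properties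
  using (shift; ++-comm)
open import Data.Maybe using (Maybe; just; nothing)
open import Data.Product using (Σ; _×_; _,_; proj₁; proj₂)
open import Function using (_∘_)
open import Relation.Nullary using (yes; no; contradiction)
open import Relation.Binary.PropositionalEquality
  using (_≡_; refl; sym; trans; cong; cong₂; subst)
open import Relation.Binary.Structures using (IsEquivalence)

module ExprRing (V : Set) where

  ≈-isEquivalence : IsEquivalence (_≈_ {V})
  ≈-isEquivalence = record { refl = ≈-refl ; sym = ≈-sym ; trans = ≈-trans }

  isCommutativeRing : IsCommutativeRing (_≈_ {V}) _⊕_ _⊗_ ⊝_ (con 0ℤ) (con 1ℤ)
  isCommutativeRing = record
    { isRing = record
      { +-isAbelianGroup = record
        { isGroup = record
          { isMonoid = record
            { isSemigroup = record
              { isMagma = record { isEquivalence = ≈-isEquivalence ; ∙-cong = ⊕-cong }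
              ; assoc = ⊕-assoc }
            ; identity = (λ p → ≈-trans (⊕-comm _ p) (⊕-idʳ p)) , ⊕-idʳ }
          ; inverse = (λ p → ≈-trans (⊕-comm _ p) (⊕-invʳ p)) , ⊕-invʳ
          ; ⁻¹-cong = ⊝-cong }
        ; comm = ⊕-comm }
      ; *-cong = ⊗-cong
      ; *-assoc = ⊗-assoc
      ; *-identity = (λ p → ≈-trans (⊗-comm _ p) (⊗-idʳ p)) , ⊗-idʳ
      ; distrib = (λ p q r → ≈-trans (⊗-comm p _)
                              (≈-trans (distribʳ q r p) (⊕-cong (⊗-comm q p) (⊗-comm r p))))
                , (λ p q r → distribʳ q r p) }
    ; *-comm = ⊗-comm }

  commutativeRing : CommutativeRing 0ℓ 0ℓ
  commutativeRing = record { isCommutativeRing = isCommutativeRing }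

  con-morphism : CommutativeRing.rawRing ℤ.+-*-commutativeRing
                   -Raw-AlmostCommutative⟶ fromCommutativeRing commutativeRing
  con-morphism = record
    { ⟦_⟧ = con ; +-homo = con-+ ; *-homo = con-* ; -‿homo = con--
    ; 0-homo = ≈-refl ; 1-homo = ≈-refl }

  con-≈? : (a b : ℤ) → Maybe (con {V} a ≈ con b)
  con-≈? a b with a ℤ.≟ b
  ... | yes refl = just ≈-refl
  ... | no _     = nothing

  open import Algebra.Solver.Ring
    (CommutativeRing.rawRing ℤ.+-*-commutativeRing)
    (fromCommutativeRing commutativeRing) con-morphism con-≈? public

≈-reflexive : ∀ {V} {p q : Expr V} → p ≡ q → p ≈ q
≈-reflexive refl = ≈-refl

-- The ideal generated by g, inductively; equivalent to _∈Ideal_ g but directly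
-- closed under the ring operations.
data ⟨_⟩ {V I : Set} (g : I → Expr V) : Expr V → Set where
  gen    : ∀ i → ⟨ g ⟩ (g i)
  0∈     : ⟨ g ⟩ (con 0ℤ)
  _+∈_   : ∀ {p q} → ⟨ g ⟩ p → ⟨ g ⟩ q → ⟨ g ⟩ (p ⊕ q)
  _*∈_   : ∀ c {p} → ⟨ g ⟩ p → ⟨ g ⟩ (c ⊗ p)
  ∈-resp : ∀ {p q} → p ≈ q → ⟨ g ⟩ p → ⟨ g ⟩ q

infixl 6 _+∈_
infixl 7 _*∈_

module _ {V : Set} where
  open ExprRing V

  infixl 6 _-∈_
  infix 4 _⊑_ _≋_

  _-∈_ : ∀ {I} {g : I → Expr V} {p q} → ⟨ g ⟩ p → ⟨ g ⟩ q → ⟨ g ⟩ (p ⊖ q)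
  _-∈_ {q = q} p∈ q∈ = p∈ +∈ ∈-resp (neg-one q) (con (-ℤ 1ℤ) *∈ q∈)
    where
    neg-one : ∀ q → con (-ℤ 1ℤ) ⊗ q ≈ ⊝ q
    neg-one = solve 1 (λ q → con (-ℤ 1ℤ) :* q := :- q) ≈-refl

  _⊑_ : ∀ {I J} → (I → Expr V) → (J → Expr V) → Set
  g ⊑ h = ∀ i → ⟨ h ⟩ (g i)

  _≋_ : ∀ {I J} → (I → Expr V) → (J → Expr V) → Set
  g ≋ h = g ⊑ h × h ⊑ g

  ⟨⟩-mono : ∀ {I J} {g : I → Expr V} {h : J → Expr V} {p} → g ⊑ h → ⟨ g ⟩ p → ⟨ h ⟩ p
  ⟨⟩-mono g⊑h (gen i)      = g⊑h i
  ⟨⟩-mono g⊑h 0∈           = 0∈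
  ⟨⟩-mono g⊑h (p∈ +∈ q∈)   = ⟨⟩-mono g⊑h p∈ +∈ ⟨⟩-mono g⊑h q∈
  ⟨⟩-mono g⊑h (c *∈ p∈)    = c *∈ ⟨⟩-mono g⊑h p∈
  ⟨⟩-mono g⊑h (∈-resp e p∈) = ∈-resp e (⟨⟩-mono g⊑h p∈)

  ⊑-trans : ∀ {I J K} {f : I → Expr V} {g : J → Expr V} {h : K → Expr V} →
            f ⊑ g → g ⊑ h → f ⊑ h
  ⊑-trans f⊑g g⊑h i = ⟨⟩-mono g⊑h (f⊑g i)

  ≋-trans : ∀ {I J K} {f : I → Expr V} {g : J → Expr V} {h : K → Expr V} →
            f ≋ g → g ≋ h → f ≋ h
  ≋-trans (f⊑g , g⊑f) (g⊑h , h⊑g) = ⊑-trans f⊑g g⊑h , ⊑-trans h⊑g g⊑f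

  ≋-sym : ∀ {I J} {g : I → Expr V} {h : J → Expr V} → g ≋ h → h ≋ g
  ≋-sym (g⊑h , h⊑g) = h⊑g , g⊑h

  pointwise-≈⇒≋ : ∀ {I} {g h : I → Expr V} → (∀ i → g i ≈ h i) → g ≋ h
  pointwise-≈⇒≋ g≈h = (λ i → ∈-resp (≈-sym (g≈h i)) (gen i)) , (λ i → ∈-resp (g≈h i) (gen i))

  Σ-≋ : ∀ {A : Set} {I J : A → Set} {g : ∀ a → I a → Expr V} {h : ∀ a → J a → Expr V} →
        (∀ a → g a ≋ h a) → (λ p → g (proj₁ p) (proj₂ p)) ≋ (λ p → h (proj₁ p) (proj₂ p))
  Σ-≋ g≋h = (λ (a , i) → ⟨⟩-mono (λ j → gen (a , j)) (proj₁ (g≋h a) i))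
          , (λ (a , j) → ⟨⟩-mono (λ i → gen (a , i)) (proj₂ (g≋h a) j))

  lincomb-++ : ∀ {I} (g : I → Expr V) cs ds → lincomb g (cs ++ ds) ≈ lincomb g cs ⊕ lincomb g ds
  lincomb-++ g []             ds = ≈-sym (≈-trans (⊕-comm _ _) (⊕-idʳ _))
  lincomb-++ g ((i , c) ∷ cs) ds =
    ≈-trans (⊕-cong ≈-refl (lincomb-++ g cs ds)) (≈-sym (⊕-assoc _ _ _))

  scale : ∀ {I : Set} → Expr V → List (I × Expr V) → List (I × Expr V)
  scale c = map (λ (i , d) → i , c ⊗ d)

  lincomb-scale : ∀ {I} (g : I → Expr V) c cs → lincomb g (scale c cs) ≈ c ⊗ lincomb g cs
  lincomb-scale g c [] = solve 1 (λ c → con 0ℤ := c :* con 0ℤ) ≈-refl c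
  lincomb-scale g c ((i , d) ∷ cs) =
    ≈-trans (⊕-cong ≈-refl (lincomb-scale g c cs))
      (solve 4 (λ c d x l → (c :* d) :* x :+ c :* l := c :* (d :* x :+ l)) ≈-refl
        c d (g i) (lincomb g cs))

  ⟨⟩⇒∈Ideal : ∀ {I} {g : I → Expr V} {p} → ⟨ g ⟩ p → p ∈Ideal g
  ⟨⟩⇒∈Ideal {g = g} (gen i) =
    ((i , con 1ℤ) ∷ []) , solve 1 (λ x → x := con 1ℤ :* x :+ con 0ℤ) ≈-refl (g i)
  ⟨⟩⇒∈Ideal 0∈ = [] , ≈-refl
  ⟨⟩⇒∈Ideal {g = g} (p∈ +∈ q∈) with ⟨⟩⇒∈Ideal p∈ | ⟨⟩⇒∈Ideal q∈
  ... | cs , p≈ | ds , q≈ = cs ++ ds , ≈-trans (⊕-cong p≈ q≈) (≈-sym (lincomb-++ g cs ds))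
  ⟨⟩⇒∈Ideal {g = g} (c *∈ p∈) with ⟨⟩⇒∈Ideal p∈
  ... | cs , p≈ = scale c cs , ≈-trans (⊗-cong ≈-refl p≈) (≈-sym (lincomb-scale g c cs))
  ⟨⟩⇒∈Ideal (∈-resp p≈q p∈) with ⟨⟩⇒∈Ideal p∈
  ... | cs , p≈ = cs , ≈-trans (≈-sym p≈q) p≈

  ∈Ideal⇒⟨⟩ : ∀ {I} {g : I → Expr V} {p} → p ∈Ideal g → ⟨ g ⟩ p
  ∈Ideal⇒⟨⟩ {g = g} (cs , p≈) = ∈-resp (≈-sym p≈) (lincomb∈ cs)
    where
    lincomb∈ : ∀ cs → ⟨ g ⟩ (lincomb g cs)
    lincomb∈ []             = 0∈
    lincomb∈ ((i , c) ∷ cs) = c *∈ gen i +∈ lincomb∈ cs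

  ≋⇒SameIdeal : ∀ {I J} {g : I → Expr V} {h : J → Expr V} → g ≋ h → SameIdeal g h
  ≋⇒SameIdeal (g⊑h , h⊑g) p =
    (λ p∈ → ⟨⟩⇒∈Ideal (⟨⟩-mono g⊑h (∈Ideal⇒⟨⟩ p∈))) ,
    (λ p∈ → ⟨⟩⇒∈Ideal (⟨⟩-mono h⊑g (∈Ideal⇒⟨⟩ p∈)))

  -- Indexed by Fin n so that δ G (v , _) is literally
  -- first (kv G v) (esDiff (outEdges G v) (inEdges G v)).
  first : (n : ℕ) → (ℕ → Expr V) → Fin n → Expr V
  first n f = f ∘ toℕ

  first-⊑ : ∀ {J} {n} (f : ℕ → Expr V) {h : J → Expr V} →
            first n f ⊑ h → ∀ {k} → k < n → ⟨ h ⟩ (f k)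
  first-⊑ f {h} fn⊑h k<n = subst (⟨ h ⟩ ∘ f) (toℕ-fromℕ< k<n) (fn⊑h (fromℕ< k<n))

  first-gen : ∀ {n} (f : ℕ → Expr V) {k} → k < n → ⟨ first n f ⟩ (f k)
  first-gen f = first-⊑ f gen

  first-≋⇒≋ : ∀ {f g : ℕ → Expr V} → (∀ n → first n f ≋ first n g) → f ≋ g
  first-≋⇒≋ {f} {g} fn≋gn =
    (λ k → ⟨⟩-mono (gen ∘ toℕ) (first-⊑ f (proj₁ (fn≋gn (suc k))) (n<1+n k))) ,
    (λ k → ⟨⟩-mono (gen ∘ toℕ) (first-⊑ g (proj₂ (fn≋gn (suc k))) (n<1+n k)))

  e-swap : ∀ l (x y : Expr V) S → e l (x ∷ y ∷ S) ≈ e l (y ∷ x ∷ S)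
  e-swap zero x y S = ≈-refl
  e-swap (suc zero) x y S =
    solve 3 (λ a x y → (a :+ y :* con 1ℤ) :+ x :* con 1ℤ := (a :+ x :* con 1ℤ) :+ y :* con 1ℤ)
      ≈-refl (e 1 S) x y
  e-swap (suc (suc l)) x y S =
    solve 5 (λ a b c x y → (a :+ y :* b) :+ x :* (b :+ y :* c)
                        := (a :+ x :* b) :+ y :* (b :+ x :* c))
      ≈-refl (e (suc (suc l)) S) (e (suc l) S) (e l S) x y

  e-cong-∷ : ∀ (x : Expr V) {S T} → (∀ l → e l S ≈ e l T) → ∀ l → e l (x ∷ S) ≈ e l (x ∷ T)
  e-cong-∷ x S≈T zero    = ≈-refl
  e-cong-∷ x S≈T (suc l) = ⊕-cong (S≈T (suc l)) (⊗-cong ≈-refl (S≈T l))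

  e-↭ : ∀ {S T : List (Expr V)} → S ↭ T → ∀ l → e l S ≈ e l T
  e-↭ ↭.refl            l = ≈-refl
  e-↭ (prep x S↭T)      = e-cong-∷ x (e-↭ S↭T)
  e-↭ (swap x y S↭T)    l = ≈-trans (e-swap l x y _) (e-cong-∷ y (e-cong-∷ x (e-↭ S↭T)) l)
  e-↭ (↭.trans S↭U U↭T) l = ≈-trans (e-↭ S↭U l) (e-↭ U↭T l)

  esDiff : List (Expr V) → List (Expr V) → ℕ → Expr V
  esDiff S T k = e (suc k) S ⊖ e (suc k) T

  esDiff-↭ : ∀ {S S′ T T′} → S ↭ S′ → T ↭ T′ → ∀ k → esDiff S T k ≈ esDiff S′ T′ k
  esDiff-↭ S↭S′ T↭T′ k = ⊕-cong (e-↭ S↭S′ (suc k)) (⊝-cong (e-↭ T↭T′ (suc k)))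

  esDiff-∷-zero : ∀ (z : Expr V) S T → esDiff (z ∷ S) (z ∷ T) 0 ≈ esDiff S T 0
  esDiff-∷-zero z S T =
    solve 3 (λ a b z → (a :+ z :* con 1ℤ) :- (b :+ z :* con 1ℤ) := a :- b) ≈-refl (e 1 S) (e 1 T) z

  esDiff-∷-suc : ∀ (z : Expr V) S T k →
                 esDiff (z ∷ S) (z ∷ T) (suc k) ≈ esDiff S T (suc k) ⊕ z ⊗ esDiff S T k
  esDiff-∷-suc z S T k =
    solve 5 (λ a b c d z → (a :+ z :* c) :- (b :+ z :* d) := (a :- b) :+ z :* (c :- d)) ≈-refl
      (e (suc (suc k)) S) (e (suc (suc k)) T) (e (suc k) S) (e (suc k) T) z

  first-esDiff-∷ : ∀ (z : Expr V) S T n →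
                   first n (esDiff (z ∷ S) (z ∷ T)) ≋ first n (esDiff S T)
  first-esDiff-∷ z S T n = (λ i → added (toℕ i) (toℕ<n i)) , (λ i → removed (toℕ i) (toℕ<n i))
    where
    added : ∀ k → k < n → ⟨ first n (esDiff S T) ⟩ (esDiff (z ∷ S) (z ∷ T) k)
    added zero    k<n = ∈-resp (≈-sym (esDiff-∷-zero z S T)) (first-gen (esDiff S T) k<n)
    added (suc k) k<n = ∈-resp (≈-sym (esDiff-∷-suc z S T k))
      (first-gen (esDiff S T) k<n +∈ z *∈ first-gen (esDiff S T) (<-trans (n<1+n k) k<n))

    removed : ∀ k → k < n → ⟨ first n (esDiff (z ∷ S) (z ∷ T)) ⟩ (esDiff S T k)
    removed zero    k<n = ∈-resp (esDiff-∷-zero z S T) (first-gen (esDiff (z ∷ S) (z ∷ T)) k<n)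
    removed (suc k) k<n = ∈-resp cancel
      (first-gen (esDiff (z ∷ S) (z ∷ T)) k<n -∈ z *∈ removed k (<-trans (n<1+n k) k<n))
      where
      cancel : esDiff (z ∷ S) (z ∷ T) (suc k) ⊖ (z ⊗ esDiff S T k) ≈ esDiff S T (suc k)
      cancel = ≈-trans (⊕-cong (esDiff-∷-suc z S T k) ≈-refl)
        (solve 2 (λ a b → (a :+ b) :- b := a) ≈-refl (esDiff S T (suc k)) (z ⊗ esDiff S T k))

  first-esDiff-++ : ∀ Z X Y n → first n (esDiff (Z ++ X) (Z ++ Y)) ≋ first n (esDiff X Y)
  first-esDiff-++ []      X Y n = pointwise-≈⇒≋ (λ _ → ≈-refl)
  first-esDiff-++ (z ∷ Z) X Y n =
    ≋-trans (first-esDiff-∷ z (Z ++ X) (Z ++ Y) n) (first-esDiff-++ Z X Y n)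

rename-e : ∀ {V W} (f : W → V) l S → rename f (e l S) ≡ e l (map (rename f) S)
rename-e f zero    S       = refl
rename-e f (suc l) []      = refl
rename-e f (suc l) (x ∷ S) =
  cong₂ (λ a b → a ⊕ (rename f x ⊗ b)) (rename-e f (suc l) S) (rename-e f l S)

rename-esDiff : ∀ {V W} (f : W → V) S T k →
                rename f (esDiff S T k) ≡ esDiff (map (rename f) S) (map (rename f) T) k
rename-esDiff f S T k =
  cong₂ (λ a b → a ⊕ (⊝ b)) (rename-e f (suc k) S) (rename-e f (suc k) T)

Δ≋Δ′ : ∀ a b c → Δ a b c ≋ Δ′ a b c
Δ≋Δ′ a b c =
  ≋-trans (pointwise-≈⇒≋ (esDiff-↭ (++-comm X Z) (++-comm Y Z)))
          (first-≋⇒≋ (first-esDiff-++ Z X Y))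
  where
  X = Xs a b c
  Y = Ys a b c
  Z = Zs a b c

module Incidence (G : Graph) where
  Edge = Fin (nE G)

  nonLoops : List Edge → List (NonLoop G)
  nonLoops []       = []
  nonLoops (x ∷ xs) with src G x ≟ tgt G x
  ... | yes _       = nonLoops xs
  ... | no nonLoop  = (x , nonLoop) ∷ nonLoops xs

  loops : List Edge → List Edge
  loops = filter (λ x → src G x ≟ tgt G x)

  ↭-loops++nonLoops : ∀ xs → map var xs ↭ map var (loops xs) ++ map (var ∘ proj₁) (nonLoops xs)
  ↭-loops++nonLoops []       = ↭.refl
  ↭-loops++nonLoops (x ∷ xs) with src G x ≟ tgt G x
  ... | yes _ = prep (var x) (↭-loops++nonLoops xs)
  ... | no _  = ↭-trans (prep (var x) (↭-loops++nonLoops xs)) (↭-sym (shift (var x) _ _))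

  loops-tgt≡loops-src : ∀ v xs → loops (filter (λ x → tgt G x ≟ v) xs)
                               ≡ loops (filter (λ x → src G x ≟ v) xs)
  loops-tgt≡loops-src v []       = refl
  loops-tgt≡loops-src v (x ∷ xs) with src G x ≟ v | tgt G x ≟ v
  ... | no _   | no _  = loops-tgt≡loops-src v xs
  ... | yes _  | yes _ with src G x ≟ tgt G x
  ...   | yes _ = cong (x ∷_) (loops-tgt≡loops-src v xs)
  ...   | no _  = loops-tgt≡loops-src v xs
  loops-tgt≡loops-src v (x ∷ xs) | yes sv | no ¬tv with src G x ≟ tgt G x
  ...   | yes loop = contradiction (trans (sym loop) sv) ¬tv
  ...   | no _     = loops-tgt≡loops-src v xs
  loops-tgt≡loops-src v (x ∷ xs) | no ¬sv | yes tv with src G x ≟ tgt G x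
  ...   | yes loop = contradiction (trans loop tv) ¬sv
  ...   | no _     = loops-tgt≡loops-src v xs

  outs ins : Fin (nV G) → List Edge
  outs v = filter (λ x → src G x ≟ v) (allFin (nE G))
  ins  v = filter (λ x → tgt G x ≟ v) (allFin (nE G))

  reducedδ : IncIndex G → Expr (NonLoop G)
  reducedδ (v , i) = esDiff (map var (nonLoops (outs v))) (map var (nonLoops (ins v))) (toℕ i)

  δ≋reducedδ-at : ∀ v → first (kv G v) (esDiff (outEdges G v) (inEdges G v))
                        ≋ (rename proj₁ ∘ reducedδ ∘ (v ,_))
  δ≋reducedδ-at v =
    ≋-trans (pointwise-≈⇒≋ (esDiff-↭ (↭-loops++nonLoops (outs v)) ins↭ ∘ toℕ))
      (≋-trans (first-esDiff-++ Z X Y (kv G v))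
               (pointwise-≈⇒≋ (λ i → ≈-reflexive (sym (renamed i)))))
    where
    X = map (var ∘ proj₁) (nonLoops (outs v))
    Y = map (var ∘ proj₁) (nonLoops (ins v))
    Z = map var (loops (outs v))

    ins↭ : inEdges G v ↭ Z ++ Y
    ins↭ = subst (λ L → inEdges G v ↭ map var L ++ Y) (loops-tgt≡loops-src v (allFin (nE G)))
                 (↭-loops++nonLoops (ins v))

    renamed : ∀ i → rename proj₁ (reducedδ (v , i)) ≡ esDiff X Y (toℕ i)
    renamed i = trans (rename-esDiff proj₁ _ _ (toℕ i))
      (cong₂ (λ S T → esDiff S T (toℕ i)) (sym (map-∘ (nonLoops (outs v))))
                                         (sym (map-∘ (nonLoops (ins v)))))

  δ≋reducedδ : δ G ≋ rename proj₁ ∘ reducedδ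
  δ≋reducedδ = Σ-≋ δ≋reducedδ-at

lemma4p13 : ((a b c : ℕ) → SameIdeal (Δ a b c) (Δ′ a b c))
    × ((G : Graph) → Σ Set λ I → Σ (I → Expr (NonLoop G)) λ g →
    SameIdeal (rename proj₁ ∘ g) (δ G))
lemma4p13 =
  (λ a b c → ≋⇒SameIdeal (Δ≋Δ′ a b c)) ,
  (λ G → let open Incidence G in
    IncIndex G , reducedδ , ≋⇒SameIdeal (≋-sym δ≋reducedδ))
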